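{- Let $f\in \mathbb{F}_q[X]\setminus\mathbb F_q[X^p]$, where $p$ is the characteristic of $\mathbb F_q$, be a universal polynomial of degree at least $8$. Then $f$ is indecomposable, i.e. it cannot be written as a composition $g\circ h$ of polynomials $g,h\in\mathbb F_q[X]$ of degree less than $\deg f$.
   Context: For a positive integer $d$, $f\in\mathbb F_q[X]$ is called $d$-universal if for every positive integer $\ell\le\deg(f)$ there exists $t_0\in\mathbb F_{q^d}$ such that $f(X)-t_0$ has an irreducible factor of degree $\ell$ in $\mathbb F_{q^d}[X]$; $f$ is universal if it is $d$-universal for some $d$. -}

module Defs where

open import Level using (0ℓ)
open import Data.Nat as ℕ using (ℕ; zero; suc; _∸_; _≤_; _<_)
open import Data.Nat.Divisibility using (_∣_)
open import Data.Nat.Primality using (Prime)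
open import Data.Fin using (Fin)
open import Data.List using (List; []; _∷_; length; foldr; map)
open import Data.Product using (Σ; ∃; _×_; _,_)
open import Data.Sum using (_⊎_)
open import Relation.Nullary using (¬_; yes; no)
open import Relation.Binary.PropositionalEquality using (_≡_; _≢_)
open import Relation.Binary.Definitions using (DecidableEquality)
open import Algebra.Structures using (IsCommutativeRing)
open import Function.Bundles using (_↔_)

-- Finite fields (equality is propositional; any finite field is
-- isomorphic to one of this form). `size` is the number of elements.

record FiniteField : Set₁ where
  infixl 7 _*_
  infixl 6 _+_
  field
    Carrier  : Set
    _+_ _*_  : Carrier → Carrier → Carrier
    -_       : Carrier → Carrier
    0# 1#    : Carrier
    isCommutativeRing : IsCommutativeRing _≡_ _+_ _*_ -_ 0# 1#
    0≢1      : 0# ≢ 1#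
    inverse  : ∀ x → x ≢ 0# → Σ Carrier (λ y → x * y ≡ 1#)
    _≟_      : DecidableEquality Carrier
    size     : ℕ
    enum     : Carrier ↔ Fin size

  natToF : ℕ → Carrier
  natToF zero    = 0#
  natToF (suc n) = 1# + natToF n

HasChar : FiniteField → ℕ → Set
HasChar F p = Prime p × (FiniteField.natToF F p ≡ FiniteField.0# F)

record FieldHom (K L : FiniteField) : Set where
  private
    module K = FiniteField K
    module L = FiniteField L
  field
    ⟦_⟧    : K.Carrier → L.Carrier
    hom-+  : ∀ x y → ⟦ x K.+ y ⟧ ≡ ⟦ x ⟧ L.+ ⟦ y ⟧
    hom-*  : ∀ x y → ⟦ x K.* y ⟧ ≡ ⟦ x ⟧ L.* ⟦ y ⟧
    hom-1  : ⟦ K.1# ⟧ ≡ L.1#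

-- L is an extension of K of degree d: an embedding K → L with |L| = |K|^d.
-- (Such an L is F_{q^d}, unique up to isomorphism over F_q.)
record Extension (K : FiniteField) (d : ℕ) : Set₁ where
  field
    L      : FiniteField
    ι      : FieldHom K L
    size-L : FiniteField.size L ≡ FiniteField.size K ℕ.^ d

-- Polynomials over a finite field: coefficient lists, lowest degree first.

module Poly (F : FiniteField) where
  open FiniteField F

  Pol : Set
  Pol = List Carrier

  strip : Pol → Pol
  strip [] = []
  strip (a ∷ as) with strip as
  ... | b ∷ bs = a ∷ b ∷ bs
  ... | [] with a ≟ 0#
  ...   | yes _ = []
  ...   | no  _ = a ∷ []

  _≈ₚ_ : Pol → Pol → Set
  p ≈ₚ q = strip p ≡ strip q

  -- degree (the zero polynomial gets degree 0)
  deg : Pol → ℕ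
  deg p = length (strip p) ∸ 1

  coeff : Pol → ℕ → Carrier
  coeff []       _       = 0#
  coeff (a ∷ as) zero    = a
  coeff (a ∷ as) (suc i) = coeff as i

  const : Carrier → Pol
  const a = a ∷ []

  _+ₚ_ : Pol → Pol → Pol
  []       +ₚ q        = q
  (a ∷ p)  +ₚ []       = a ∷ p
  (a ∷ p)  +ₚ (b ∷ q)  = (a + b) ∷ (p +ₚ q)

  scale : Carrier → Pol → Pol
  scale a = map (a *_)

  _*ₚ_ : Pol → Pol → Pol
  []      *ₚ q = []
  (a ∷ p) *ₚ q = scale a q +ₚ (0# ∷ (p *ₚ q))

  -- composition g ∘ h  (Horner)
  _∘ₚ_ : Pol → Pol → Pol
  g ∘ₚ h = foldr (λ a acc → const a +ₚ (h *ₚ acc)) [] g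

  _∣ₚ_ : Pol → Pol → Set
  g ∣ₚ h = Σ Pol (λ k → (g *ₚ k) ≈ₚ h)

  Irreducible : Pol → Set
  Irreducible g = (1 ≤ deg g) ×
    (∀ a b → (a *ₚ b) ≈ₚ g → deg a ≡ 0 ⊎ deg b ≡ 0)

  NotInXp : ℕ → Pol → Set
  NotInXp p f = Σ ℕ (λ i → (¬ (p ∣ i)) × (coeff f i ≢ 0#))

  Indecomposable : Pol → Set
  Indecomposable f = ∀ g h → deg g < deg f → deg h < deg f → ¬ (f ≈ₚ (g ∘ₚ h))

module _ (F : FiniteField) where
  open FiniteField F
  open Poly F using () renaming (Pol to PolF; deg to degF)

  DUniversal : ℕ → PolF → Set₁
  DUniversal d f = Σ (Extension F d) λ E →
    let open Extension E
        open FieldHom ι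
        open Poly L
        fL = map ⟦_⟧ f
    in ∀ ℓ → 1 ≤ ℓ → ℓ ≤ degF f →
         Σ (FiniteField.Carrier L) λ t₀ →
         Σ Pol λ g → Irreducible g × (deg g ≡ ℓ) ×
           (g ∣ₚ (fL +ₚ const (FiniteField.-_ L t₀)))

  Universal : PolF → Set₁
  Universal f = Σ ℕ λ d → (1 ≤ d) × DUniversal d f

-- If f = g ∘ h with deg g, deg h < deg f, then deg h ≥ 2. Universality for ℓ = deg f − 1
-- gives, over the extension, t and an irreducible P of degree deg f − 1 dividing f − t, so
-- f − t = c (X − r) P has a root r. Then g(h(r)) = t, hence h − h(r) divides f − t, and
-- X − r divides h − h(r). Cancelling X − r leaves c P = H Q with deg H = deg h − 1 ≥ 1 and
-- deg Q = deg f − deg h ≥ 1, contradicting the irreducibility of P.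
module Submission where

open import Defs
open import Data.Nat using (ℕ; _≤_)
open import Data.Nat as ℕ using (zero; suc; _∸_; _<_; z≤n; s≤s)
import Data.Nat.Properties as ℕ
open import Data.List using ([]; _∷_; length; map)
open import Data.Product using (Σ-syntax; _×_; _,_; proj₁; proj₂)
open import Data.Sum using (_⊎_; inj₁; inj₂; [_,_])
open import Data.Unit using (⊤; tt)
open import Data.Empty using (⊥-elim)
open import Function using (_∘_)
open import Level using (0ℓ)
open import Relation.Nullary using (¬_; yes; no)
open import Relation.Binary.Bundles using (Setoid)
open import Relation.Binary.PropositionalEquality
  using (_≡_; _≢_; refl; sym; trans; cong; cong₂; subst; subst₂; module ≡-Reasoning)
open import Algebra.Bundles using (CommutativeRing)
open import Relation.Binary.Definitions using (tri<; tri≈; tri>)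
import Relation.Binary.Reasoning.Setoid as SetoidReasoning

m*n≡o⇒m<o⇒2≤n : ∀ m n {o} → m ℕ.* n ≡ o → m < o → 2 ≤ n
m*n≡o⇒m<o⇒2≤n m zero          m*0≡o m<o = ⊥-elim (ℕ.n≮0 (subst (m <_) (trans (sym m*0≡o) (ℕ.*-zeroʳ m)) m<o))
m*n≡o⇒m<o⇒2≤n m (suc zero)    m*1≡o m<o = ⊥-elim (ℕ.<-irrefl (trans (sym (ℕ.*-identityʳ m)) m*1≡o) m<o)
m*n≡o⇒m<o⇒2≤n m (suc (suc n)) _     _   = s≤s (s≤s z≤n)

module Polynomials (F : FiniteField) where
  open FiniteField F
  open Poly F public

  private
    commutativeRing : CommutativeRing 0ℓ 0ℓ
    commutativeRing = record { isCommutativeRing = isCommutativeRing }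

  open CommutativeRing commutativeRing public
    using (+-identityˡ; +-identityʳ; +-comm; +-assoc; zeroˡ; zeroʳ;
           *-identityˡ; *-identityʳ; *-comm; -‿inverseˡ; -‿inverseʳ)
  open CommutativeRing commutativeRing using (commutativeSemiring; ring)
  open import Algebra.Properties.Ring ring public
    using (-‿distribʳ-*; -‿involutive; -1*x≈-x; x∙y⁻¹≈ε⇒x≈y; x+x≈x⇒x≈0)
  open import Algebra.Solver.Ring.NaturalCoefficients.Default commutativeSemiring
    using (solve; _:=_; _:+_; _:*_)

  1≢0 : 1# ≢ 0#
  1≢0 1≡0 = 0≢1 (sym 1≡0)

  *-≢0 : ∀ {x y} → x ≢ 0# → y ≢ 0# → x * y ≢ 0#
  *-≢0 {x} {y} x≢0 y≢0 xy≡0 with inverse x x≢0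
  ... | x⁻¹ , xx⁻¹≡1 = y≢0 (begin
      y                ≡⟨ *-identityˡ y ⟨
      1# * y           ≡⟨ cong (_* y) xx⁻¹≡1 ⟨
      (x * x⁻¹) * y    ≡⟨ solve 3 (λ x x⁻¹ y → (x :* x⁻¹) :* y := x⁻¹ :* (x :* y)) refl x x⁻¹ y ⟩
      x⁻¹ * (x * y)    ≡⟨ cong (x⁻¹ *_) xy≡0 ⟩
      x⁻¹ * 0#         ≡⟨ zeroʳ x⁻¹ ⟩
      0#               ∎)
    where open ≡-Reasoning

  -- Coefficientwise equality: the list representation has trailing-zero junk.
  infix 4 _≋_
  record _≋_ (p q : Pol) : Set where
    constructor coeffwise
    field coeff-≡ : ∀ i → coeff p i ≡ coeff q i
  open _≋_ public

  IsZero : Pol → Set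
  IsZero p = p ≋ []

  ≋-refl : ∀ {p} → p ≋ p
  ≋-refl = coeffwise λ _ → refl

  ≋-sym : ∀ {p q} → p ≋ q → q ≋ p
  ≋-sym p≋q = coeffwise λ i → sym (coeff-≡ p≋q i)

  ≋-trans : ∀ {p q r} → p ≋ q → q ≋ r → p ≋ r
  ≋-trans p≋q q≋r = coeffwise λ i → trans (coeff-≡ p≋q i) (coeff-≡ q≋r i)

  ≋-setoid : Setoid 0ℓ 0ℓ
  ≋-setoid = record
    { Carrier       = Pol
    ; _≈_           = _≋_
    ; isEquivalence = record { refl = ≋-refl ; sym = ≋-sym ; trans = ≋-trans }
    }

  module ≋-Reasoning = SetoidReasoning ≋-setoid

  ∷-cong : ∀ {a b p q} → a ≡ b → p ≋ q → (a ∷ p) ≋ (b ∷ q)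
  ∷-cong a≡b p≋q = coeffwise λ where
    zero    → a≡b
    (suc i) → coeff-≡ p≋q i

  ∷-injectiveʳ : ∀ {a b p q} → (a ∷ p) ≋ (b ∷ q) → p ≋ q
  ∷-injectiveʳ e = coeffwise λ i → coeff-≡ e (suc i)

  isZero-∷ : ∀ {a p} → IsZero (a ∷ p) → IsZero p
  isZero-∷ z = coeffwise λ i → coeff-≡ z (suc i)

  const-isZero : ∀ {a} → a ≡ 0# → IsZero (const a)
  const-isZero a≡0 = coeffwise λ where
    zero    → a≡0
    (suc i) → refl

  0∷-isZero : ∀ {p} → IsZero p → IsZero (0# ∷ p)
  0∷-isZero z = coeffwise λ where
    zero    → refl
    (suc i) → coeff-≡ z i

  coeff-+ₚ : ∀ p q i → coeff (p +ₚ q) i ≡ coeff p i + coeff q i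
  coeff-+ₚ []      q       i       = sym (+-identityˡ _)
  coeff-+ₚ (a ∷ p) []      i       = sym (+-identityʳ _)
  coeff-+ₚ (a ∷ p) (b ∷ q) zero    = refl
  coeff-+ₚ (a ∷ p) (b ∷ q) (suc i) = coeff-+ₚ p q i

  coeff-scale : ∀ a p i → coeff (scale a p) i ≡ a * coeff p i
  coeff-scale a []      i       = sym (zeroʳ a)
  coeff-scale a (b ∷ p) zero    = refl
  coeff-scale a (b ∷ p) (suc i) = coeff-scale a p i

  coeff-scale-+ₚ : ∀ c p q i → coeff (scale c p +ₚ q) i ≡ c * coeff p i + coeff q i
  coeff-scale-+ₚ c p q i = trans (coeff-+ₚ (scale c p) q i) (cong (_+ coeff q i) (coeff-scale c p i))

  coeff-0∷-+ₚ : ∀ p q i → coeff (0# ∷ (p +ₚ q)) i ≡ coeff (0# ∷ p) i + coeff (0# ∷ q) i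
  coeff-0∷-+ₚ p q zero    = sym (+-identityʳ 0#)
  coeff-0∷-+ₚ p q (suc i) = coeff-+ₚ p q i

  coeff-0∷-scale : ∀ a p i → coeff (0# ∷ scale a p) i ≡ a * coeff (0# ∷ p) i
  coeff-0∷-scale a p zero    = sym (zeroʳ a)
  coeff-0∷-scale a p (suc i) = coeff-scale a p i

  coeff-∷-*ₚ : ∀ a p q i → coeff ((a ∷ p) *ₚ q) i ≡ a * coeff q i + coeff (0# ∷ (p *ₚ q)) i
  coeff-∷-*ₚ a p q = coeff-scale-+ₚ a q (0# ∷ (p *ₚ q))

  +ₚ-cong : ∀ {p p′ q q′} → p ≋ p′ → q ≋ q′ → (p +ₚ q) ≋ (p′ +ₚ q′)
  +ₚ-cong {p} {p′} {q} {q′} p≋p′ q≋q′ = coeffwise λ i →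
    trans (coeff-+ₚ p q i) (trans (cong₂ _+_ (coeff-≡ p≋p′ i) (coeff-≡ q≋q′ i)) (sym (coeff-+ₚ p′ q′ i)))

  scale-cong : ∀ {a b p q} → a ≡ b → p ≋ q → scale a p ≋ scale b q
  scale-cong {a} {b} {p} {q} a≡b p≋q = coeffwise λ i →
    trans (coeff-scale a p i) (trans (cong₂ _*_ a≡b (coeff-≡ p≋q i)) (sym (coeff-scale b q i)))

  +ₚ-comm : ∀ p q → (p +ₚ q) ≋ (q +ₚ p)
  +ₚ-comm p q = coeffwise λ i →
    trans (coeff-+ₚ p q i) (trans (+-comm _ _) (sym (coeff-+ₚ q p i)))

  +ₚ-assoc : ∀ p q r → ((p +ₚ q) +ₚ r) ≋ (p +ₚ (q +ₚ r))
  +ₚ-assoc p q r = coeffwise λ i → begin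
    coeff ((p +ₚ q) +ₚ r) i                ≡⟨ coeff-+ₚ (p +ₚ q) r i ⟩
    coeff (p +ₚ q) i + coeff r i           ≡⟨ cong (_+ coeff r i) (coeff-+ₚ p q i) ⟩
    (coeff p i + coeff q i) + coeff r i    ≡⟨ +-assoc _ _ _ ⟩
    coeff p i + (coeff q i + coeff r i)    ≡⟨ cong (coeff p i +_) (coeff-+ₚ q r i) ⟨
    coeff p i + coeff (q +ₚ r) i           ≡⟨ coeff-+ₚ p (q +ₚ r) i ⟨
    coeff (p +ₚ (q +ₚ r)) i                ∎
    where open ≡-Reasoning

  +ₚ-isZeroʳ : ∀ p {q} → IsZero q → (p +ₚ q) ≋ p
  +ₚ-isZeroʳ p {q} z = coeffwise λ i →
    trans (coeff-+ₚ p q i) (trans (cong (coeff p i +_) (coeff-≡ z i)) (+-identityʳ _))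

  +ₚ-const-cancel : ∀ p a → ((p +ₚ const a) +ₚ const (- a)) ≋ p
  +ₚ-const-cancel p a = ≋-trans (+ₚ-assoc p (const a) (const (- a)))
                                (+ₚ-isZeroʳ p (const-isZero (-‿inverseʳ a)))

  scale-isZero : ∀ p → IsZero (scale 0# p)
  scale-isZero p = coeffwise λ i → trans (coeff-scale 0# p i) (zeroˡ _)

  scale-assoc : ∀ a b p → scale a (scale b p) ≋ scale (a * b) p
  scale-assoc a b p = coeffwise λ i → begin
    coeff (scale a (scale b p)) i  ≡⟨ coeff-scale a (scale b p) i ⟩
    a * coeff (scale b p) i        ≡⟨ cong (a *_) (coeff-scale b p i) ⟩
    a * (b * coeff p i)            ≡⟨ solve 3 (λ a b x → a :* (b :* x) := (a :* b) :* x) refl a b (coeff p i) ⟩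
    (a * b) * coeff p i            ≡⟨ coeff-scale (a * b) p i ⟨
    coeff (scale (a * b) p) i      ∎
    where open ≡-Reasoning

  scale-identity : ∀ p → scale 1# p ≋ p
  scale-identity p = coeffwise λ i → trans (coeff-scale 1# p i) (*-identityˡ _)

  *ₚ-zeroˡ : ∀ p q → IsZero p → IsZero (p *ₚ q)
  *ₚ-zeroˡ []      q z = ≋-refl
  *ₚ-zeroˡ (a ∷ p) q z = coeffwise λ i → begin
    coeff ((a ∷ p) *ₚ q) i                    ≡⟨ coeff-∷-*ₚ a p q i ⟩
    a * coeff q i + coeff (0# ∷ (p *ₚ q)) i   ≡⟨ cong₂ _+_ (trans (cong (_* coeff q i) (coeff-≡ z 0)) (zeroˡ _))
                                                          (coeff-≡ (0∷-isZero (*ₚ-zeroˡ p q (isZero-∷ z))) i) ⟩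
    0# + 0#                                   ≡⟨ +-identityʳ 0# ⟩
    0#                                        ∎
    where open ≡-Reasoning

  *ₚ-zeroʳ : ∀ p q → IsZero q → IsZero (p *ₚ q)
  *ₚ-zeroʳ []      q z = ≋-refl
  *ₚ-zeroʳ (a ∷ p) q z = coeffwise λ i → begin
    coeff ((a ∷ p) *ₚ q) i                    ≡⟨ coeff-∷-*ₚ a p q i ⟩
    a * coeff q i + coeff (0# ∷ (p *ₚ q)) i   ≡⟨ cong₂ _+_ (trans (cong (a *_) (coeff-≡ z i)) (zeroʳ a))
                                                          (coeff-≡ (0∷-isZero (*ₚ-zeroʳ p q z)) i) ⟩
    0# + 0#                                   ≡⟨ +-identityʳ 0# ⟩
    0#                                        ∎
    where open ≡-Reasoning

  *ₚ-congʳ : ∀ {p p′} q → p ≋ p′ → (p *ₚ q) ≋ (p′ *ₚ q)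
  *ₚ-congʳ {[]}    {[]}     q e = ≋-refl
  *ₚ-congʳ {[]}    {b ∷ p′} q e = ≋-sym (*ₚ-zeroˡ (b ∷ p′) q (≋-sym e))
  *ₚ-congʳ {a ∷ p} {[]}     q e = *ₚ-zeroˡ (a ∷ p) q e
  *ₚ-congʳ {a ∷ p} {b ∷ p′} q e =
    +ₚ-cong (scale-cong (coeff-≡ e 0) ≋-refl) (∷-cong refl (*ₚ-congʳ q (∷-injectiveʳ e)))

  *ₚ-congˡ : ∀ p {q q′} → q ≋ q′ → (p *ₚ q) ≋ (p *ₚ q′)
  *ₚ-congˡ []      e = ≋-refl
  *ₚ-congˡ (a ∷ p) e = +ₚ-cong (scale-cong refl e) (∷-cong refl (*ₚ-congˡ p e))

  *ₚ-distribˡ-+ₚ : ∀ p q r → (p *ₚ (q +ₚ r)) ≋ ((p *ₚ q) +ₚ (p *ₚ r))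
  *ₚ-distribˡ-+ₚ []      q r = ≋-refl
  *ₚ-distribˡ-+ₚ (a ∷ p) q r = coeffwise λ i → begin
    coeff ((a ∷ p) *ₚ (q +ₚ r)) i
      ≡⟨ coeff-∷-*ₚ a p (q +ₚ r) i ⟩
    a * coeff (q +ₚ r) i + coeff (0# ∷ (p *ₚ (q +ₚ r))) i
      ≡⟨ cong₂ _+_ (cong (a *_) (coeff-+ₚ q r i))
                   (trans (coeff-≡ (∷-cong refl (*ₚ-distribˡ-+ₚ p q r)) i) (coeff-0∷-+ₚ (p *ₚ q) (p *ₚ r) i)) ⟩
    a * (coeff q i + coeff r i) + (coeff (0# ∷ (p *ₚ q)) i + coeff (0# ∷ (p *ₚ r)) i)
      ≡⟨ solve 5 (λ a x y u v → a :* (x :+ y) :+ (u :+ v) := (a :* x :+ u) :+ (a :* y :+ v))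
               refl a (coeff q i) (coeff r i) (coeff (0# ∷ (p *ₚ q)) i) (coeff (0# ∷ (p *ₚ r)) i) ⟩
    (a * coeff q i + coeff (0# ∷ (p *ₚ q)) i) + (a * coeff r i + coeff (0# ∷ (p *ₚ r)) i)
      ≡⟨ cong₂ _+_ (coeff-∷-*ₚ a p q i) (coeff-∷-*ₚ a p r i) ⟨
    coeff ((a ∷ p) *ₚ q) i + coeff ((a ∷ p) *ₚ r) i
      ≡⟨ coeff-+ₚ ((a ∷ p) *ₚ q) ((a ∷ p) *ₚ r) i ⟨
    coeff (((a ∷ p) *ₚ q) +ₚ ((a ∷ p) *ₚ r)) i
      ∎
    where open ≡-Reasoning

  scale-*ₚˡ : ∀ a p q → (scale a p *ₚ q) ≋ scale a (p *ₚ q)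
  scale-*ₚˡ a []      q = ≋-refl
  scale-*ₚˡ a (b ∷ p) q = coeffwise λ i → begin
    coeff ((a * b ∷ scale a p) *ₚ q) i
      ≡⟨ coeff-∷-*ₚ (a * b) (scale a p) q i ⟩
    (a * b) * coeff q i + coeff (0# ∷ (scale a p *ₚ q)) i
      ≡⟨ cong ((a * b) * coeff q i +_)
              (trans (coeff-≡ (∷-cong refl (scale-*ₚˡ a p q)) i) (coeff-0∷-scale a (p *ₚ q) i)) ⟩
    (a * b) * coeff q i + a * coeff (0# ∷ (p *ₚ q)) i
      ≡⟨ solve 4 (λ a b x u → (a :* b) :* x :+ a :* u := a :* (b :* x :+ u))
               refl a b (coeff q i) (coeff (0# ∷ (p *ₚ q)) i) ⟩
    a * (b * coeff q i + coeff (0# ∷ (p *ₚ q)) i)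
      ≡⟨ cong (a *_) (coeff-∷-*ₚ b p q i) ⟨
    a * coeff ((b ∷ p) *ₚ q) i
      ≡⟨ coeff-scale a ((b ∷ p) *ₚ q) i ⟨
    coeff (scale a ((b ∷ p) *ₚ q)) i
      ∎
    where open ≡-Reasoning

  0∷-*ₚ : ∀ p q → ((0# ∷ p) *ₚ q) ≋ (0# ∷ (p *ₚ q))
  0∷-*ₚ p q = coeffwise λ i →
    trans (coeff-∷-*ₚ 0# p q i) (trans (cong (_+ coeff (0# ∷ (p *ₚ q)) i) (zeroˡ (coeff q i))) (+-identityˡ _))

  *ₚ-∷ : ∀ q a p → (q *ₚ (a ∷ p)) ≋ (scale a q +ₚ (0# ∷ (q *ₚ p)))
  *ₚ-∷ q a p = coeffwise (go q)
    where
    open ≡-Reasoning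
    go : ∀ q i → coeff (q *ₚ (a ∷ p)) i ≡ coeff (scale a q +ₚ (0# ∷ (q *ₚ p))) i
    go []      zero    = refl
    go []      (suc i) = refl
    go (b ∷ q) zero    = cong (_+ 0#) (*-comm b a)
    go (b ∷ q) (suc i) = begin
      coeff ((b ∷ q) *ₚ (a ∷ p)) (suc i)
        ≡⟨ coeff-∷-*ₚ b q (a ∷ p) (suc i) ⟩
      b * coeff p i + coeff (q *ₚ (a ∷ p)) i
        ≡⟨ cong (b * coeff p i +_) (trans (go q i) (coeff-scale-+ₚ a q (0# ∷ (q *ₚ p)) i)) ⟩
      b * coeff p i + (a * coeff q i + coeff (0# ∷ (q *ₚ p)) i)
        ≡⟨ solve 3 (λ x y u → x :+ (y :+ u) := y :+ (x :+ u))
                 refl (b * coeff p i) (a * coeff q i) (coeff (0# ∷ (q *ₚ p)) i) ⟩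
      a * coeff q i + (b * coeff p i + coeff (0# ∷ (q *ₚ p)) i)
        ≡⟨ cong₂ _+_ (coeff-scale a q i) (coeff-∷-*ₚ b q p i) ⟨
      coeff (scale a q) i + coeff ((b ∷ q) *ₚ p) i
        ≡⟨ coeff-+ₚ (scale a (b ∷ q)) (0# ∷ ((b ∷ q) *ₚ p)) (suc i) ⟨
      coeff (scale a (b ∷ q) +ₚ (0# ∷ ((b ∷ q) *ₚ p))) (suc i)
        ∎

  *ₚ-comm : ∀ p q → (p *ₚ q) ≋ (q *ₚ p)
  *ₚ-comm []      q = ≋-sym (*ₚ-zeroʳ q [] ≋-refl)
  *ₚ-comm (a ∷ p) q = ≋-trans (+ₚ-cong ≋-refl (∷-cong refl (*ₚ-comm p q))) (≋-sym (*ₚ-∷ q a p))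

  *ₚ-distribʳ-+ₚ : ∀ r p q → ((p +ₚ q) *ₚ r) ≋ ((p *ₚ r) +ₚ (q *ₚ r))
  *ₚ-distribʳ-+ₚ r p q = ≋-trans (*ₚ-comm (p +ₚ q) r)
    (≋-trans (*ₚ-distribˡ-+ₚ r p q) (+ₚ-cong (*ₚ-comm r p) (*ₚ-comm r q)))

  scale-*ₚʳ : ∀ a p q → (p *ₚ scale a q) ≋ scale a (p *ₚ q)
  scale-*ₚʳ a p q = ≋-trans (*ₚ-comm p (scale a q)) (≋-trans (scale-*ₚˡ a q p) (scale-cong refl (*ₚ-comm q p)))

  *ₚ-assoc : ∀ p q r → ((p *ₚ q) *ₚ r) ≋ (p *ₚ (q *ₚ r))
  *ₚ-assoc []      q r = ≋-refl
  *ₚ-assoc (a ∷ p) q r = ≋-trans (*ₚ-distribʳ-+ₚ r (scale a q) (0# ∷ (p *ₚ q)))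
    (+ₚ-cong (scale-*ₚˡ a q r) (≋-trans (0∷-*ₚ (p *ₚ q) r) (∷-cong refl (*ₚ-assoc p q r))))

  *ₚ-const : ∀ p c → (p *ₚ const c) ≋ scale c p
  *ₚ-const p c = ≋-trans (*ₚ-∷ p c []) (+ₚ-isZeroʳ (scale c p) (0∷-isZero (*ₚ-zeroʳ p [] ≋-refl)))

  X : Pol
  X = 0# ∷ 1# ∷ []

  X-*ₚ : ∀ p → (X *ₚ p) ≋ (0# ∷ p)
  X-*ₚ p = ≋-trans (+ₚ-isZeroʳ′ (scale-isZero p)) (∷-cong refl one)
    where
    +ₚ-isZeroʳ′ : ∀ {z q} → IsZero z → (z +ₚ q) ≋ q
    +ₚ-isZeroʳ′ {z} {q} iz = ≋-trans (+ₚ-comm z q) (+ₚ-isZeroʳ q iz)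
    one : ((1# ∷ []) *ₚ p) ≋ p
    one = ≋-trans (+ₚ-isZeroʳ (scale 1# p) (0∷-isZero ≋-refl)) (scale-identity p)

  X−_ : Carrier → Pol
  X− r = X +ₚ const (- r)

  -- Composition, evaluation and the factor theorem

  ∘ₚ-zeroˡ : ∀ g h → IsZero g → IsZero (g ∘ₚ h)
  ∘ₚ-zeroˡ []      h z = ≋-refl
  ∘ₚ-zeroˡ (a ∷ g) h z =
    +ₚ-cong (const-isZero (coeff-≡ z 0)) (*ₚ-zeroʳ h (g ∘ₚ h) (∘ₚ-zeroˡ g h (isZero-∷ z)))

  ∘ₚ-X : ∀ g → (g ∘ₚ X) ≋ g
  ∘ₚ-X []      = ≋-refl
  ∘ₚ-X (a ∷ g) = ≋-trans (+ₚ-cong (≋-refl {const a}) (≋-trans (X-*ₚ (g ∘ₚ X)) (∷-cong refl (∘ₚ-X g))))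
                         (∷-cong (+-identityʳ a) ≋-refl)

  eval : Pol → Carrier → Carrier
  eval []      x = 0#
  eval (a ∷ p) x = a + x * eval p x

  eval-isZero : ∀ p x → IsZero p → eval p x ≡ 0#
  eval-isZero []      x z = refl
  eval-isZero (a ∷ p) x z =
    trans (cong₂ _+_ (coeff-≡ z 0) (trans (cong (x *_) (eval-isZero p x (isZero-∷ z))) (zeroʳ x))) (+-identityʳ 0#)

  eval-cong : ∀ {p q} x → p ≋ q → eval p x ≡ eval q x
  eval-cong {[]}    {[]}    x e = refl
  eval-cong {[]}    {b ∷ q} x e = sym (eval-isZero (b ∷ q) x (≋-sym e))
  eval-cong {a ∷ p} {[]}    x e = eval-isZero (a ∷ p) x e
  eval-cong {a ∷ p} {b ∷ q} x e = cong₂ _+_ (coeff-≡ e 0) (cong (x *_) (eval-cong x (∷-injectiveʳ e)))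

  eval-+ₚ : ∀ p q x → eval (p +ₚ q) x ≡ eval p x + eval q x
  eval-+ₚ []      q       x = sym (+-identityˡ _)
  eval-+ₚ (a ∷ p) []      x = sym (+-identityʳ _)
  eval-+ₚ (a ∷ p) (b ∷ q) x = trans (cong (λ y → (a + b) + x * y) (eval-+ₚ p q x))
    (solve 5 (λ a b x u v → (a :+ b) :+ x :* (u :+ v) := (a :+ x :* u) :+ (b :+ x :* v)) refl a b x (eval p x) (eval q x))

  eval-scale : ∀ a p x → eval (scale a p) x ≡ a * eval p x
  eval-scale a []      x = sym (zeroʳ a)
  eval-scale a (b ∷ p) x = trans (cong (λ y → a * b + x * y) (eval-scale a p x))
    (solve 4 (λ a b x u → a :* b :+ x :* (a :* u) := a :* (b :+ x :* u)) refl a b x (eval p x))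

  eval-0∷ : ∀ p x → eval (0# ∷ p) x ≡ x * eval p x
  eval-0∷ p x = +-identityˡ _

  eval-*ₚ : ∀ p q x → eval (p *ₚ q) x ≡ eval p x * eval q x
  eval-*ₚ []      q x = sym (zeroˡ _)
  eval-*ₚ (a ∷ p) q x = begin
    eval (scale a q +ₚ (0# ∷ (p *ₚ q))) x        ≡⟨ eval-+ₚ (scale a q) (0# ∷ (p *ₚ q)) x ⟩
    eval (scale a q) x + eval (0# ∷ (p *ₚ q)) x  ≡⟨ cong₂ _+_ (eval-scale a q x) (eval-0∷ (p *ₚ q) x) ⟩
    a * eval q x + x * eval (p *ₚ q) x           ≡⟨ cong (λ y → a * eval q x + x * y) (eval-*ₚ p q x) ⟩
    a * eval q x + x * (eval p x * eval q x)
      ≡⟨ solve 4 (λ a x u v → a :* v :+ x :* (u :* v) := (a :+ x :* u) :* v) refl a x (eval p x) (eval q x) ⟩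
    (a + x * eval p x) * eval q x                ∎
    where open ≡-Reasoning

  eval-const : ∀ a x → eval (const a) x ≡ a
  eval-const a x = trans (cong (a +_) (zeroʳ x)) (+-identityʳ a)

  eval-∘ₚ : ∀ g h x → eval (g ∘ₚ h) x ≡ eval g (eval h x)
  eval-∘ₚ []      h x = refl
  eval-∘ₚ (a ∷ g) h x = begin
    eval (const a +ₚ (h *ₚ (g ∘ₚ h))) x          ≡⟨ eval-+ₚ (const a) (h *ₚ (g ∘ₚ h)) x ⟩
    eval (const a) x + eval (h *ₚ (g ∘ₚ h)) x    ≡⟨ cong₂ _+_ (eval-const a x) (eval-*ₚ h (g ∘ₚ h) x) ⟩
    a + eval h x * eval (g ∘ₚ h) x               ≡⟨ cong (λ y → a + eval h x * y) (eval-∘ₚ g h x) ⟩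
    a + eval h x * eval g (eval h x)             ∎
    where open ≡-Reasoning

  eval-+ₚ-const-zero⇒ : ∀ p a x → eval (p +ₚ const (- a)) x ≡ 0# → eval p x ≡ a
  eval-+ₚ-const-zero⇒ p a x e = x∙y⁻¹≈ε⇒x≈y (eval p x) a
    (trans (cong (eval p x +_) (sym (eval-const (- a) x))) (trans (sym (eval-+ₚ p (const (- a)) x)) e))

  eval-+ₚ-const-own-value : ∀ p x → eval (p +ₚ const (- eval p x)) x ≡ 0#
  eval-+ₚ-const-own-value p x =
    trans (eval-+ₚ p (const (- eval p x)) x) (trans (cong (eval p x +_) (eval-const _ x)) (-‿inverseʳ _))

  eval-X−-root : ∀ r → eval (X− r) r ≡ 0#
  eval-X−-root r =
    trans (eval-+ₚ X (const (- r)) r) (trans (cong₂ _+_ eval-X (eval-const (- r) r)) (-‿inverseʳ r))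
    where
    eval-X : eval X r ≡ r
    eval-X = trans (+-identityˡ _) (trans (cong (λ y → r * (1# + y)) (zeroʳ r))
                   (trans (cong (r *_) (+-identityʳ 1#)) (*-identityʳ r)))

  scale-+ₚ-const-recentre : ∀ c h s a →
    (scale c h +ₚ const a) ≋ (scale c (h +ₚ const (- s)) +ₚ const (a + s * c))
  scale-+ₚ-const-recentre c h s a = coeffwise λ i →
    trans (coeff-scale-+ₚ c h (const a) i)
      (trans (recentre i)
        (sym (trans (coeff-scale-+ₚ c (h +ₚ const (- s)) (const (a + s * c)) i)
                    (cong (λ y → c * y + _) (coeff-+ₚ h (const (- s)) i)))))
    where
    open ≡-Reasoning
    cs-cancel : c * - s + s * c ≡ 0#
    cs-cancel = trans (cong₂ _+_ (sym (-‿distribʳ-* c s)) (*-comm s c)) (-‿inverseˡ (c * s))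
    recentre : ∀ i → c * coeff h i + coeff (const a) i
                   ≡ c * (coeff h i + coeff (const (- s)) i) + coeff (const (a + s * c)) i
    recentre zero    = sym (begin
      c * (coeff h 0 + - s) + (a + s * c)
        ≡⟨ solve 5 (λ c x m a s → c :* (x :+ m) :+ (a :+ s :* c) := (c :* x :+ a) :+ (c :* m :+ s :* c))
                 refl c (coeff h 0) (- s) a s ⟩
      (c * coeff h 0 + a) + (c * - s + s * c)  ≡⟨ cong (c * coeff h 0 + a +_) cs-cancel ⟩
      (c * coeff h 0 + a) + 0#                 ≡⟨ +-identityʳ _ ⟩
      c * coeff h 0 + a                        ∎)
    recentre (suc i) = cong (λ y → c * y + 0#) (sym (+-identityʳ (coeff h (suc i))))

  factor-theorem : ∀ A h s → Σ[ Q ∈ Pol ] (A ∘ₚ h) ≋ (((h +ₚ const (- s)) *ₚ Q) +ₚ const (eval A s))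
  factor-theorem []      h s = [] , ≋-sym (+ₚ-cong (*ₚ-zeroʳ (h +ₚ const (- s)) [] ≋-refl) (const-isZero refl))
  factor-theorem (a ∷ A) h s with factor-theorem A h s
  ... | Q , A∘h≋ = (h *ₚ Q) +ₚ const c , (begin
      const a +ₚ (h *ₚ (A ∘ₚ h))
        ≈⟨ +ₚ-cong (≋-refl {const a}) (≋-trans (*ₚ-congˡ h A∘h≋) (*ₚ-distribˡ-+ₚ h (h−s *ₚ Q) (const c))) ⟩
      const a +ₚ ((h *ₚ (h−s *ₚ Q)) +ₚ (h *ₚ const c))
        ≈⟨ +ₚ-cong (≋-refl {const a}) (+ₚ-cong swap (*ₚ-const h c)) ⟩
      const a +ₚ (W +ₚ scale c h)
        ≈⟨ ≋-trans (+ₚ-comm (const a) (W +ₚ scale c h)) (+ₚ-assoc W (scale c h) (const a)) ⟩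
      W +ₚ (scale c h +ₚ const a)
        ≈⟨ +ₚ-cong (≋-refl {W}) (scale-+ₚ-const-recentre c h s a) ⟩
      W +ₚ (scale c h−s +ₚ const (a + s * c))
        ≈⟨ +ₚ-assoc W (scale c h−s) (const (a + s * c)) ⟨
      (W +ₚ scale c h−s) +ₚ const (a + s * c)
        ≈⟨ +ₚ-cong (≋-trans (*ₚ-distribˡ-+ₚ h−s (h *ₚ Q) (const c)) (+ₚ-cong (≋-refl {W}) (*ₚ-const h−s c)))
                   (≋-refl {const (a + s * c)}) ⟨
      (h−s *ₚ ((h *ₚ Q) +ₚ const c)) +ₚ const (a + s * c)
        ∎)
    where
    open ≋-Reasoning
    c = eval A s
    h−s = h +ₚ const (- s)
    W = h−s *ₚ (h *ₚ Q)
    swap : (h *ₚ (h−s *ₚ Q)) ≋ W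
    swap = ≋-trans (≋-sym (*ₚ-assoc h h−s Q)) (≋-trans (*ₚ-congʳ Q (*ₚ-comm h h−s)) (*ₚ-assoc h−s h Q))

  factor-root : ∀ A r → eval A r ≡ 0# → Σ[ Q ∈ Pol ] A ≋ ((X− r) *ₚ Q)
  factor-root A r Ar≡0 with factor-theorem A X r
  ... | Q , A∘X≋ = Q , (begin
      A                                   ≈⟨ ∘ₚ-X A ⟨
      A ∘ₚ X                              ≈⟨ A∘X≋ ⟩
      ((X− r) *ₚ Q) +ₚ const (eval A r)   ≈⟨ +ₚ-isZeroʳ _ (const-isZero Ar≡0) ⟩
      (X− r) *ₚ Q                         ∎)
    where open ≋-Reasoning

  -- Degrees

  DegreeAtMost : Pol → ℕ → Set
  DegreeAtMost p d = ∀ i → d < i → coeff p i ≡ 0#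

  -- A record rather than a product, so that p can be inferred from HasDegree p d.
  record HasDegree (p : Pol) (d : ℕ) : Set where
    constructor _,_
    field
      leading≢0 : coeff p d ≢ 0#
      bounded   : DegreeAtMost p d

  hasDegree-cong : ∀ {p q d} → p ≋ q → HasDegree p d → HasDegree q d
  hasDegree-cong {d = d} p≋q (p≢0 , p≤d) =
    (λ q≡0 → p≢0 (trans (coeff-≡ p≋q d) q≡0)) , λ i d<i → trans (sym (coeff-≡ p≋q i)) (p≤d i d<i)

  hasDegree⇒¬isZero : ∀ {p d} → HasDegree p d → ¬ IsZero p
  hasDegree⇒¬isZero {d = d} (p≢0 , _) z = p≢0 (coeff-≡ z d)

  degreeAtMost-∷ : ∀ {a g m} → DegreeAtMost (a ∷ g) (suc m) → DegreeAtMost g m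
  degreeAtMost-∷ g≤ i m<i = g≤ (suc i) (s≤s m<i)

  degreeAtMost-0-∷ : ∀ {a g} → DegreeAtMost (a ∷ g) 0 → IsZero g
  degreeAtMost-0-∷ g≤ = coeffwise λ i → g≤ (suc i) (s≤s z≤n)

  coeff-length : ∀ p i → length p ≤ i → coeff p i ≡ 0#
  coeff-length []      i       _         = refl
  coeff-length (a ∷ p) (suc i) (s≤s p≤i) = coeff-length p i p≤i

  -- The recursion of `strip` as a function, so that it can be reasoned about.
  consNormal : Carrier → Pol → Pol
  consNormal a (b ∷ bs) = a ∷ b ∷ bs
  consNormal a [] with a ≟ 0#
  ... | yes _ = []
  ... | no  _ = a ∷ []

  strip-∷ : ∀ a as → strip (a ∷ as) ≡ consNormal a (strip as)
  strip-∷ a as with strip as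
  ... | b ∷ bs = refl
  ... | [] with a ≟ 0#
  ...   | yes _ = refl
  ...   | no  _ = refl

  consNormal-≋ : ∀ a s → consNormal a s ≋ (a ∷ s)
  consNormal-≋ a (b ∷ bs) = ≋-refl
  consNormal-≋ a [] with a ≟ 0#
  ... | yes a≡0 = ≋-sym (const-isZero a≡0)
  ... | no  _   = ≋-refl

  consNormal-isZero : ∀ {a} → a ≡ 0# → consNormal a [] ≡ []
  consNormal-isZero {a} a≡0 with a ≟ 0#
  ... | yes _   = refl
  ... | no  a≢0 = ⊥-elim (a≢0 a≡0)

  strip-≋ : ∀ p → strip p ≋ p
  strip-≋ []       = ≋-refl
  strip-≋ (a ∷ as) = ≋-trans (coeffwise λ i → cong (λ s → coeff s i) (strip-∷ a as))
                             (≋-trans (consNormal-≋ a (strip as)) (∷-cong refl (strip-≋ as)))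

  strip-isZero : ∀ p → IsZero p → strip p ≡ []
  strip-isZero []       z = refl
  strip-isZero (a ∷ as) z =
    trans (strip-∷ a as) (trans (cong (consNormal a) (strip-isZero as (isZero-∷ z))) (consNormal-isZero (coeff-≡ z 0)))

  ≋⇒≈ₚ : ∀ {p q} → p ≋ q → p ≈ₚ q
  ≋⇒≈ₚ {[]}    {[]}    e = refl
  ≋⇒≈ₚ {[]}    {b ∷ q} e = sym (strip-isZero (b ∷ q) (≋-sym e))
  ≋⇒≈ₚ {a ∷ p} {[]}    e = strip-isZero (a ∷ p) e
  ≋⇒≈ₚ {a ∷ p} {b ∷ q} e =
    trans (strip-∷ a p) (trans (cong₂ consNormal (coeff-≡ e 0) (≋⇒≈ₚ (∷-injectiveʳ e))) (sym (strip-∷ b q)))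

  ≈ₚ⇒≋ : ∀ {p q} → p ≈ₚ q → p ≋ q
  ≈ₚ⇒≋ {p} {q} e = ≋-trans (≋-sym (strip-≋ p)) (≋-trans (coeffwise λ i → cong (λ s → coeff s i) e) (strip-≋ q))

  deg-cong : ∀ {p q} → p ≋ q → deg p ≡ deg q
  deg-cong e = cong (λ s → length s ∸ 1) (≋⇒≈ₚ e)

  deg-isZero : ∀ {p} → IsZero p → deg p ≡ 0
  deg-isZero = deg-cong

  Normal : Pol → Set
  Normal []           = ⊤
  Normal (a ∷ [])     = a ≢ 0#
  Normal (a ∷ b ∷ bs) = Normal (b ∷ bs)

  consNormal-normal : ∀ a s → Normal s → Normal (consNormal a s)
  consNormal-normal a (b ∷ bs) n = n
  consNormal-normal a [] n with a ≟ 0#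
  ... | yes _   = tt
  ... | no  a≢0 = a≢0

  strip-normal : ∀ p → Normal (strip p)
  strip-normal []       = tt
  strip-normal (a ∷ as) =
    subst Normal (sym (strip-∷ a as)) (consNormal-normal a (strip as) (strip-normal as))

  normal-last≢0 : ∀ a s → Normal (a ∷ s) → coeff (a ∷ s) (length s) ≢ 0#
  normal-last≢0 a []       n = n
  normal-last≢0 a (b ∷ bs) n = normal-last≢0 b bs n

  zero-or-hasDegree : ∀ p → IsZero p ⊎ HasDegree p (deg p)
  zero-or-hasDegree p = classify (strip p) (strip-normal p) (strip-≋ p)
    where
    classify : ∀ s → Normal s → s ≋ p → IsZero p ⊎ HasDegree p (length s ∸ 1)
    classify []      _ s≋p = inj₁ (≋-sym s≋p)
    classify (a ∷ s) n s≋p = inj₂ (hasDegree-cong s≋p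
      (normal-last≢0 a s n , λ i s<i → coeff-length (a ∷ s) i s<i))

  hasDegree⇒deg≡ : ∀ {p d} → HasDegree p d → deg p ≡ d
  hasDegree⇒deg≡ {p} {d} (p≢0 , p≤d) with zero-or-hasDegree p
  ... | inj₁ z = ⊥-elim (p≢0 (coeff-≡ z d))
  ... | inj₂ (p≢0′ , p≤deg) with ℕ.<-cmp (deg p) d
  ...   | tri< deg<d _ _ = ⊥-elim (p≢0 (p≤deg d deg<d))
  ...   | tri≈ _ deg≡d _ = deg≡d
  ...   | tri> _ _ d<deg = ⊥-elim (p≢0′ (p≤d (deg p) d<deg))

  ¬isZero⇒hasDegree : ∀ {p} → ¬ IsZero p → HasDegree p (deg p)
  ¬isZero⇒hasDegree {p} p≢0 with zero-or-hasDegree p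
  ... | inj₁ z  = ⊥-elim (p≢0 z)
  ... | inj₂ p° = p°

  degreeAtMost-deg : ∀ p → DegreeAtMost p (deg p)
  degreeAtMost-deg p with zero-or-hasDegree p
  ... | inj₁ z        = λ i _ → coeff-≡ z i
  ... | inj₂ (_ , p≤) = p≤

  degreeAtMost⇒deg≤ : ∀ {p d} → DegreeAtMost p d → deg p ≤ d
  degreeAtMost⇒deg≤ {p} {d} p≤d with zero-or-hasDegree p
  ... | inj₁ z        = subst (_≤ d) (sym (deg-isZero z)) z≤n
  ... | inj₂ (p≢0 , _) with deg p ℕ.≤? d
  ...   | yes deg≤d = deg≤d
  ...   | no  deg≰d = ⊥-elim (p≢0 (p≤d (deg p) (ℕ.≰⇒> deg≰d)))

  deg≥1⇒¬isZero : ∀ {p} → 1 ≤ deg p → ¬ IsZero p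
  deg≥1⇒¬isZero 1≤deg z = ℕ.<⇒≢ 1≤deg (sym (deg-isZero z))

  *ₚ-top : ∀ p q {m n} → DegreeAtMost p m → DegreeAtMost q n →
           (coeff (p *ₚ q) (m ℕ.+ n) ≡ coeff p m * coeff q n) × DegreeAtMost (p *ₚ q) (m ℕ.+ n)
  *ₚ-top []      q         p≤ q≤ = sym (zeroˡ _) , λ _ _ → refl
  *ₚ-top (a ∷ p) q {zero} {n} p≤ q≤ = top , bound
    where
    p≋0 : IsZero p
    p≋0 = degreeAtMost-0-∷ p≤
    tail≡0 : ∀ i → coeff (0# ∷ (p *ₚ q)) i ≡ 0#
    tail≡0 = coeff-≡ (0∷-isZero (*ₚ-zeroˡ p q p≋0))
    top = trans (coeff-∷-*ₚ a p q n) (trans (cong (a * coeff q n +_) (tail≡0 n)) (+-identityʳ _))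
    bound : DegreeAtMost ((a ∷ p) *ₚ q) _
    bound i n<i = trans (coeff-∷-*ₚ a p q i)
      (trans (cong₂ _+_ (trans (cong (a *_) (q≤ i n<i)) (zeroʳ a)) (tail≡0 i)) (+-identityʳ _))
  *ₚ-top (a ∷ p) q {suc m} {n} p≤ q≤ = top , bound
    where
    ih = *ₚ-top p q (degreeAtMost-∷ p≤) q≤
    a-term≡0 : ∀ {i} → n < i → a * coeff q i ≡ 0#
    a-term≡0 n<i = trans (cong (a *_) (q≤ _ n<i)) (zeroʳ a)
    top = trans (coeff-∷-*ₚ a p q (suc (m ℕ.+ n)))
      (trans (cong₂ _+_ (a-term≡0 (s≤s (ℕ.m≤n+m n m))) (proj₁ ih)) (+-identityˡ _))
    bound : DegreeAtMost ((a ∷ p) *ₚ q) (suc (m ℕ.+ n))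
    bound (suc j) (s≤s m+n<j) = trans (coeff-∷-*ₚ a p q (suc j))
      (trans (cong₂ _+_ (a-term≡0 (s≤s (ℕ.≤-trans (ℕ.m≤n+m n m) (ℕ.<⇒≤ m+n<j)))) (proj₂ ih j m+n<j))
             (+-identityʳ _))

  *ₚ-hasDegree : ∀ {p q m n} → HasDegree p m → HasDegree q n → HasDegree (p *ₚ q) (m ℕ.+ n)
  *ₚ-hasDegree {p} {q} (p≢0 , p≤) (q≢0 , q≤) with *ₚ-top p q p≤ q≤
  ... | top≡ , bound = (λ top≡0 → *-≢0 p≢0 q≢0 (trans (sym top≡) top≡0)) , bound

  *ₚ-¬isZero : ∀ {p q} → ¬ IsZero p → ¬ IsZero q → ¬ IsZero (p *ₚ q)
  *ₚ-¬isZero p≢0 q≢0 = hasDegree⇒¬isZero (*ₚ-hasDegree (¬isZero⇒hasDegree p≢0) (¬isZero⇒hasDegree q≢0))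

  deg-≋*ₚ : ∀ {r p q} → ¬ IsZero r → r ≋ (p *ₚ q) → deg r ≡ deg p ℕ.+ deg q
  deg-≋*ₚ {r} {p} {q} r≢0 r≋pq =
    trans (deg-cong r≋pq) (hasDegree⇒deg≡ (*ₚ-hasDegree (¬isZero⇒hasDegree p≢0) (¬isZero⇒hasDegree q≢0)))
    where
    p≢0 : ¬ IsZero p
    p≢0 z = r≢0 (≋-trans r≋pq (*ₚ-zeroˡ p q z))
    q≢0 : ¬ IsZero q
    q≢0 z = r≢0 (≋-trans r≋pq (*ₚ-zeroʳ p q z))

  deg-scale : ∀ {c} → c ≢ 0# → ∀ p → deg (scale c p) ≡ deg p
  deg-scale {c} c≢0 p with zero-or-hasDegree p
  ... | inj₁ z = trans (deg-isZero cp≋0) (sym (deg-isZero z))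
    where
    cp≋0 : IsZero (scale c p)
    cp≋0 = coeffwise λ i → trans (coeff-scale c p i) (trans (cong (c *_) (coeff-≡ z i)) (zeroʳ c))
  ... | inj₂ (p≢0 , p≤) = hasDegree⇒deg≡ {scale c p}
    ( (λ e → *-≢0 c≢0 p≢0 (trans (sym (coeff-scale c p (deg p))) e))
    , λ i deg<i → trans (coeff-scale c p i) (trans (cong (c *_) (p≤ i deg<i)) (zeroʳ c)))

  +ₚ-const-hasDegree : ∀ {p d} c → 1 ≤ d → HasDegree p d → HasDegree (p +ₚ const c) d
  +ₚ-const-hasDegree {p} {suc d} c _ (p≢0 , p≤) = top≢0 , bound
    where
    top≢0 : coeff (p +ₚ const c) (suc d) ≢ 0#
    top≢0 e = p≢0 (trans (sym (+-identityʳ _)) (trans (sym (coeff-+ₚ p (const c) (suc d))) e))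
    bound : DegreeAtMost (p +ₚ const c) (suc d)
    bound (suc j) d<j = trans (coeff-+ₚ p (const c) (suc j)) (trans (+-identityʳ _) (p≤ (suc j) d<j))

  deg-+ₚ-const : ∀ {p} c → 1 ≤ deg p → deg (p +ₚ const c) ≡ deg p
  deg-+ₚ-const {p} c 1≤deg = hasDegree⇒deg≡ {p +ₚ const c}
    (+ₚ-const-hasDegree {p} c 1≤deg (¬isZero⇒hasDegree {p} (deg≥1⇒¬isZero {p} 1≤deg)))

  deg-X− : ∀ r → deg (X− r) ≡ 1
  deg-X− r = hasDegree⇒deg≡ {X− r} (1≢0 , bound)
    where
    bound : DegreeAtMost (X− r) 1
    bound (suc zero)    (s≤s ())
    bound (suc (suc j)) _ = refl

  coeff-∘ₚ-suc : ∀ a g h j → coeff ((a ∷ g) ∘ₚ h) (suc j) ≡ coeff (h *ₚ (g ∘ₚ h)) (suc j)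
  coeff-∘ₚ-suc a g h j = trans (coeff-+ₚ (const a) (h *ₚ (g ∘ₚ h)) (suc j)) (+-identityˡ _)

  ∘ₚ-degreeAtMost : ∀ g h {m n} → DegreeAtMost g m → DegreeAtMost h n → DegreeAtMost (g ∘ₚ h) (m ℕ.* n)
  ∘ₚ-degreeAtMost []      h         g≤ h≤ i       _ = refl
  ∘ₚ-degreeAtMost (a ∷ g) h {zero}  g≤ h≤ (suc j) _ = trans (coeff-∘ₚ-suc a g h j)
    (coeff-≡ (*ₚ-zeroʳ h (g ∘ₚ h) (∘ₚ-zeroˡ g h (degreeAtMost-0-∷ g≤))) (suc j))
  ∘ₚ-degreeAtMost (a ∷ g) h {suc m} g≤ h≤ (suc j) mn<j = trans (coeff-∘ₚ-suc a g h j)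
    (proj₂ (*ₚ-top h (g ∘ₚ h) h≤ (∘ₚ-degreeAtMost g h (degreeAtMost-∷ g≤) h≤)) (suc j) mn<j)

  ∘ₚ-hasDegree : ∀ g h {m n} → HasDegree g m → HasDegree h n → 1 ≤ n → HasDegree (g ∘ₚ h) (m ℕ.* n)
  ∘ₚ-hasDegree []      h         (g≢0 , _) _ _ = ⊥-elim (g≢0 refl)
  ∘ₚ-hasDegree (a ∷ g) h {zero}  (a≢0 , g≤) (_ , h≤) _ = top≢0 , ∘ₚ-degreeAtMost (a ∷ g) h g≤ h≤
    where
    top≢0 : coeff ((a ∷ g) ∘ₚ h) 0 ≢ 0#
    top≢0 e = a≢0 (begin
      a                                      ≡⟨ +-identityʳ a ⟨
      a + 0#                                 ≡⟨ cong (a +_) (coeff-≡ h*g∘h≋0 0) ⟨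
      a + coeff (h *ₚ (g ∘ₚ h)) 0            ≡⟨ coeff-+ₚ (const a) (h *ₚ (g ∘ₚ h)) 0 ⟨
      coeff ((a ∷ g) ∘ₚ h) 0                 ≡⟨ e ⟩
      0#                                     ∎)
      where
      open ≡-Reasoning
      h*g∘h≋0 : IsZero (h *ₚ (g ∘ₚ h))
      h*g∘h≋0 = *ₚ-zeroʳ h (g ∘ₚ h) (∘ₚ-zeroˡ g h (degreeAtMost-0-∷ g≤))
  ∘ₚ-hasDegree (a ∷ g) h {suc m} {n} (g≢0 , g≤) h° 1≤n =
    hasDegree-cong (+ₚ-comm (h *ₚ (g ∘ₚ h)) (const a))
      (+ₚ-const-hasDegree a (ℕ.≤-trans 1≤n (ℕ.m≤m+n n _))
        (*ₚ-hasDegree h° (∘ₚ-hasDegree g h (g≢0 , degreeAtMost-∷ g≤) h° 1≤n)))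

  deg-∘ₚ : ∀ g h → deg (g ∘ₚ h) ≡ deg g ℕ.* deg h
  deg-∘ₚ g h with zero-or-hasDegree g | deg h ℕ.≟ 0
  ... | inj₁ g≋0 | _ =
    trans (deg-isZero {g ∘ₚ h} (∘ₚ-zeroˡ g h g≋0)) (cong (ℕ._* deg h) (sym (deg-isZero {g} g≋0)))
  ... | inj₂ _ | yes degh≡0 = trans (ℕ.n≤0⇒n≡0 (degreeAtMost⇒deg≤ {g ∘ₚ h} constant)) (sym product≡0)
    where
    product≡0 : deg g ℕ.* deg h ≡ 0
    product≡0 = trans (cong (deg g ℕ.*_) degh≡0) (ℕ.*-zeroʳ (deg g))
    constant : DegreeAtMost (g ∘ₚ h) 0
    constant = subst (DegreeAtMost (g ∘ₚ h)) product≡0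
                     (∘ₚ-degreeAtMost g h (degreeAtMost-deg g) (degreeAtMost-deg h))
  ... | inj₂ g° | no degh≢0 = hasDegree⇒deg≡
    (∘ₚ-hasDegree g h g° (¬isZero⇒hasDegree {h} (λ z → degh≢0 (deg-isZero {h} z))) (ℕ.n≢0⇒n>0 degh≢0))

  -- Cancellation and the obstruction to decomposability

  coeff-+ₚ-scale-neg : ∀ p q i → coeff (p +ₚ scale (- 1#) q) i ≡ coeff p i + - coeff q i
  coeff-+ₚ-scale-neg p q i = trans (coeff-+ₚ p (scale (- 1#) q) i)
    (cong (coeff p i +_) (trans (coeff-scale (- 1#) q i) (-1*x≈-x (coeff q i))))

  +ₚ-scale-neg-isZero : ∀ p → IsZero (p +ₚ scale (- 1#) p)
  +ₚ-scale-neg-isZero p = coeffwise λ i → trans (coeff-+ₚ-scale-neg p p i) (-‿inverseʳ _)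

  *ₚ-cancelˡ : ∀ C {A B} → ¬ IsZero C → (C *ₚ A) ≋ (C *ₚ B) → A ≋ B
  *ₚ-cancelˡ C {A} {B} C≢0 CA≋CB = from (zero-or-hasDegree D)
    where
    D = A +ₚ scale (- 1#) B
    CD≋0 : IsZero (C *ₚ D)
    CD≋0 = begin
      C *ₚ D                              ≈⟨ *ₚ-distribˡ-+ₚ C A (scale (- 1#) B) ⟩
      (C *ₚ A) +ₚ (C *ₚ scale (- 1#) B)   ≈⟨ +ₚ-cong (≋-refl {C *ₚ A}) (≋-trans (scale-*ₚʳ (- 1#) C B)
                                                                                (scale-cong refl (≋-sym CA≋CB))) ⟩
      (C *ₚ A) +ₚ scale (- 1#) (C *ₚ A)   ≈⟨ +ₚ-scale-neg-isZero (C *ₚ A) ⟩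
      []                                  ∎
      where open ≋-Reasoning
    from : IsZero D ⊎ HasDegree D (deg D) → A ≋ B
    from (inj₂ D°)  = ⊥-elim (*ₚ-¬isZero C≢0 (hasDegree⇒¬isZero D°) CD≋0)
    from (inj₁ D≋0) = coeffwise λ i →
      x∙y⁻¹≈ε⇒x≈y (coeff A i) (coeff B i) (trans (sym (coeff-+ₚ-scale-neg A B i)) (coeff-≡ D≋0 i))

  degree-one-form : ∀ {k} → HasDegree k 1 → Σ[ r ∈ Carrier ] k ≋ scale (coeff k 1) (X− r)
  degree-one-form {k} (k₁≢0 , k≤1) with inverse (coeff k 1) k₁≢0
  ... | y , k₁y≡1 = - (k₀ * y) , coeffwise λ where
      zero          → sym (begin
        k₁ * (0# + - - (k₀ * y))   ≡⟨ cong (k₁ *_) (trans (+-identityˡ _) (-‿involutive _)) ⟩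
        k₁ * (k₀ * y)              ≡⟨ solve 3 (λ a b y → a :* (b :* y) := b :* (a :* y)) refl k₁ k₀ y ⟩
        k₀ * (k₁ * y)              ≡⟨ cong (k₀ *_) k₁y≡1 ⟩
        k₀ * 1#                    ≡⟨ *-identityʳ k₀ ⟩
        k₀                         ∎)
      (suc zero)    → sym (*-identityʳ k₁)
      (suc (suc i)) → k≤1 (suc (suc i)) (s≤s (s≤s z≤n))
    where
    open ≡-Reasoning
    k₀ = coeff k 0
    k₁ = coeff k 1

  eval-≋-X−*ₚ : ∀ {A B} r → A ≋ ((X− r) *ₚ B) → eval A r ≡ 0#
  eval-≋-X−*ₚ {A} {B} r A≋ = begin
    eval A r                      ≡⟨ eval-cong r A≋ ⟩
    eval ((X− r) *ₚ B) r          ≡⟨ eval-*ₚ (X− r) B r ⟩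
    eval (X− r) r * eval B r      ≡⟨ cong (_* eval B r) (eval-X−-root r) ⟩
    0# * eval B r                 ≡⟨ zeroˡ _ ⟩
    0#                            ∎
    where open ≡-Reasoning

  cofactor-of-codegree-one : ∀ {G P k} → 1 ≤ deg G → deg P ≡ deg G ∸ 1 → G ≋ (P *ₚ k) → HasDegree k 1
  cofactor-of-codegree-one {G} {P} {k} 1≤G degP G≋Pk =
    subst (HasDegree k) degk≡1 (¬isZero⇒hasDegree (λ z → G≢0 (≋-trans G≋Pk (*ₚ-zeroʳ P k z))))
    where
    G≢0 : ¬ IsZero G
    G≢0 = deg≥1⇒¬isZero 1≤G
    degk≡1 : deg k ≡ 1
    degk≡1 = ℕ.+-cancelˡ-≡ (deg G ∸ 1) (deg k) 1
      (trans (cong (ℕ._+ deg k) (sym degP)) (trans (sym (deg-≋*ₚ {G} {P} {k} G≢0 G≋Pk)) (sym (ℕ.m∸n+n≡m 1≤G))))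

  codegree-one-factor : ∀ {G P} → 1 ≤ deg G → deg P ≡ deg G ∸ 1 → P ∣ₚ G →
                        Σ[ r ∈ Carrier ] Σ[ c ∈ Carrier ] c ≢ 0# × G ≋ ((X− r) *ₚ scale c P)
  codegree-one-factor {G} {P} 1≤G degP (k , Pk≈G) = linear (cofactor-of-codegree-one {G} {P} {k} 1≤G degP G≋Pk)
    where
    G≋Pk : G ≋ (P *ₚ k)
    G≋Pk = ≋-sym (≈ₚ⇒≋ Pk≈G)
    linear : HasDegree k 1 → Σ[ r ∈ Carrier ] Σ[ c ∈ Carrier ] c ≢ 0# × G ≋ ((X− r) *ₚ scale c P)
    linear k° with degree-one-form k°
    ... | r , k≋ = r , c , HasDegree.leading≢0 k° , (begin
        G                       ≈⟨ G≋Pk ⟩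
        P *ₚ k                  ≈⟨ *ₚ-congˡ P k≋ ⟩
        P *ₚ scale c (X− r)     ≈⟨ scale-*ₚʳ c P (X− r) ⟩
        scale c (P *ₚ (X− r))   ≈⟨ scale-cong refl (*ₚ-comm P (X− r)) ⟩
        scale c ((X− r) *ₚ P)   ≈⟨ scale-*ₚʳ c (X− r) P ⟨
        (X− r) *ₚ scale c P     ∎)
      where
      open ≋-Reasoning
      c = coeff k 1

  composite-shift-factors : ∀ {f g h} t r → f ≋ (g ∘ₚ h) → eval f r ≡ t →
    Σ[ H ∈ Pol ] Σ[ Q ∈ Pol ] (h +ₚ const (- eval h r)) ≋ ((X− r) *ₚ H)
                            × (f +ₚ const (- t)) ≋ ((h +ₚ const (- eval h r)) *ₚ Q)
  composite-shift-factors {f} {g} {h} t r f≋g∘h fr≡t = proj₁ H-factor , Q , proj₂ H-factor , (begin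
    f +ₚ const (- t)                                ≈⟨ +ₚ-cong (≋-trans f≋g∘h g∘h≋) (≋-refl {const (- t)}) ⟩
    ((h−s *ₚ Q) +ₚ const (eval g s)) +ₚ const (- t)
      ≡⟨ cong (λ v → ((h−s *ₚ Q) +ₚ const v) +ₚ const (- t)) gs≡t ⟩
    ((h−s *ₚ Q) +ₚ const t) +ₚ const (- t)          ≈⟨ +ₚ-const-cancel (h−s *ₚ Q) t ⟩
    h−s *ₚ Q                                        ∎)
    where
    open ≋-Reasoning
    s = eval h r
    h−s = h +ₚ const (- s)
    H-factor = factor-root h−s r (eval-+ₚ-const-own-value h r)
    Q = proj₁ (factor-theorem g h s)
    g∘h≋ = proj₂ (factor-theorem g h s)
    gs≡t : eval g s ≡ t
    gs≡t = trans (sym (eval-∘ₚ g h r)) (trans (sym (eval-cong r f≋g∘h)) fr≡t)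

  scale-factorisation : ∀ {c P A B} → c ≢ 0# → scale c P ≋ (A *ₚ B) →
                        Σ[ d ∈ Carrier ] d ≢ 0# × (scale d A *ₚ B) ≋ P
  scale-factorisation {c} {P} {A} {B} c≢0 cP≋AB = c⁻¹ , c⁻¹≢0 , (begin
    scale c⁻¹ A *ₚ B           ≈⟨ scale-*ₚˡ c⁻¹ A B ⟩
    scale c⁻¹ (A *ₚ B)         ≈⟨ scale-cong refl (≋-sym cP≋AB) ⟩
    scale c⁻¹ (scale c P)      ≈⟨ scale-assoc c⁻¹ c P ⟩
    scale (c⁻¹ * c) P          ≈⟨ scale-cong (trans (*-comm c⁻¹ c) cc⁻¹≡1) ≋-refl ⟩
    scale 1# P                 ≈⟨ scale-identity P ⟩
    P                          ∎)
    where
    open ≋-Reasoning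
    c⁻¹ = proj₁ (inverse c c≢0)
    cc⁻¹≡1 = proj₂ (inverse c c≢0)
    c⁻¹≢0 : c⁻¹ ≢ 0#
    c⁻¹≢0 c⁻¹≡0 = 1≢0 (trans (sym cc⁻¹≡1) (trans (cong (c *_) c⁻¹≡0) (zeroʳ c)))

  shift-cofactors-nonconstant : ∀ {f h H Q} t s r → 2 ≤ deg h → deg h < deg f →
    (h +ₚ const (- s)) ≋ ((X− r) *ₚ H) → (f +ₚ const (- t)) ≋ ((h +ₚ const (- s)) *ₚ Q) →
    deg H ≢ 0 × deg Q ≢ 0
  shift-cofactors-nonconstant {f} {h} {H} {Q} t s r 2≤h h<f h−s≋ f−t≋ = H-nonconstant , Q-nonconstant
    where
    open ≡-Reasoning
    h−s = h +ₚ const (- s)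
    1≤h : 1 ≤ deg h
    1≤h = ℕ.<⇒≤ 2≤h
    1≤f : 1 ≤ deg f
    1≤f = ℕ.<⇒≤ (ℕ.≤-<-trans 1≤h h<f)
    deg-h−s : deg h−s ≡ deg h
    deg-h−s = deg-+ₚ-const {h} (- s) 1≤h
    deg-f−t : deg (f +ₚ const (- t)) ≡ deg f
    deg-f−t = deg-+ₚ-const {f} (- t) 1≤f
    H-nonconstant : deg H ≢ 0
    H-nonconstant degH≡0 = ℕ.<-irrefl refl (subst (2 ≤_) h≡1 2≤h)
      where
      h≡1 : deg h ≡ 1
      h≡1 = begin
        deg h                  ≡⟨ deg-h−s ⟨
        deg h−s                ≡⟨ deg-≋*ₚ {h−s} {X− r} {H}
                                      (deg≥1⇒¬isZero {h−s} (subst (1 ≤_) (sym deg-h−s) 1≤h)) h−s≋ ⟩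
        deg (X− r) ℕ.+ deg H   ≡⟨ cong₂ ℕ._+_ (deg-X− r) degH≡0 ⟩
        1                      ∎
    Q-nonconstant : deg Q ≢ 0
    Q-nonconstant degQ≡0 = ℕ.<-irrefl (sym f≡h) h<f
      where
      f≡h : deg f ≡ deg h
      f≡h = begin
        deg f                    ≡⟨ deg-f−t ⟨
        deg (f +ₚ const (- t))   ≡⟨ deg-≋*ₚ {f +ₚ const (- t)} {h−s} {Q}
                                      (deg≥1⇒¬isZero {f +ₚ const (- t)} (subst (1 ≤_) (sym deg-f−t) 1≤f)) f−t≋ ⟩
        deg h−s ℕ.+ deg Q        ≡⟨ cong₂ ℕ._+_ deg-h−s degQ≡0 ⟩
        deg h ℕ.+ 0              ≡⟨ ℕ.+-identityʳ (deg h) ⟩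
        deg h                    ∎

  decomposable-shift-splits : ∀ {f g h P} t r {c} → c ≢ 0# → f ≋ (g ∘ₚ h) → 2 ≤ deg h → deg h < deg f →
    (f +ₚ const (- t)) ≋ ((X− r) *ₚ scale c P) →
    Σ[ A ∈ Pol ] Σ[ B ∈ Pol ] (A *ₚ B) ≋ P × deg A ≢ 0 × deg B ≢ 0
  decomposable-shift-splits {f} {g} {h} {P} t r {c} c≢0 f≋g∘h 2≤h h<f f−t≋ =
    split (composite-shift-factors {f} {g} {h} t r f≋g∘h (eval-+ₚ-const-zero⇒ f t r (eval-≋-X−*ₚ r f−t≋)))
    where
    h−s = h +ₚ const (- eval h r)
    split : Σ[ H ∈ Pol ] Σ[ Q ∈ Pol ] h−s ≋ ((X− r) *ₚ H) × (f +ₚ const (- t)) ≋ (h−s *ₚ Q) →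
            Σ[ A ∈ Pol ] Σ[ B ∈ Pol ] (A *ₚ B) ≋ P × deg A ≢ 0 × deg B ≢ 0
    split (H , Q , h−s≋ , f−t≋h−sQ) =
      let d , d≢0 , dHQ≋P = scale-factorisation {c} {P} {H} {Q} c≢0 cP≋HQ
          H≢0 , Q≢0       = shift-cofactors-nonconstant {f} {h} {H} {Q} t (eval h r) r 2≤h h<f h−s≋ f−t≋h−sQ
      in  scale d H , Q , dHQ≋P , H≢0 ∘ trans (sym (deg-scale d≢0 H)) , Q≢0
      where
      cP≋HQ : scale c P ≋ (H *ₚ Q)
      cP≋HQ = *ₚ-cancelˡ (X− r) (deg≥1⇒¬isZero {X− r} (ℕ.≤-reflexive (sym (deg-X− r)))) (begin
        (X− r) *ₚ scale c P    ≈⟨ ≋-trans (≋-sym f−t≋) f−t≋h−sQ ⟩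
        h−s *ₚ Q               ≈⟨ *ₚ-congʳ Q h−s≋ ⟩
        ((X− r) *ₚ H) *ₚ Q     ≈⟨ *ₚ-assoc (X− r) H Q ⟩
        (X− r) *ₚ (H *ₚ Q)     ∎)
        where open ≋-Reasoning

  decomposition-inner-degree : ∀ {f g h} → f ≋ (g ∘ₚ h) → deg g < deg f → 2 ≤ deg h
  decomposition-inner-degree {f} {g} {h} f≋g∘h =
    m*n≡o⇒m<o⇒2≤n (deg g) (deg h) (trans (sym (deg-∘ₚ g h)) (sym (deg-cong f≋g∘h)))

  decomposable⇒no-irreducible-factor-of-degree-pred : ∀ {f g h P} t →
    f ≋ (g ∘ₚ h) → deg g < deg f → deg h < deg f →
    Irreducible P → deg P ≡ deg f ∸ 1 → ¬ (P ∣ₚ (f +ₚ const (- t)))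
  decomposable⇒no-irreducible-factor-of-degree-pred {f} {g} {h} {P} t f≋g∘h g<f h<f (_ , irreducible) degP P∣f−t =
    let r , c , c≢0 , f−t≋ = codegree-one-factor {f +ₚ const (- t)} {P}
                                (subst (1 ≤_) (sym deg-f−t) 1≤f) (trans degP (cong (_∸ 1) (sym deg-f−t))) P∣f−t
        A , B , AB≋P , A≢0 , B≢0 = decomposable-shift-splits {f} {g} {h} {P} t r {c} c≢0 f≋g∘h
                                      (decomposition-inner-degree {f} {g} {h} f≋g∘h g<f) h<f f−t≋
    in  [ A≢0 , B≢0 ] (irreducible A B (≋⇒≈ₚ AB≋P))
    where
    1≤f : 1 ≤ deg f
    1≤f = ℕ.≤-<-trans z≤n h<f
    deg-f−t : deg (f +ₚ const (- t)) ≡ deg f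
    deg-f−t = deg-+ₚ-const {f} (- t) 1≤f

module Transfer {K L : FiniteField} (ι : FieldHom K L) where
  private
    module K = FiniteField K
    module L = FiniteField L
    module PK = Polynomials K
    module PL = Polynomials L
  open PL using (_,_)
  open FieldHom ι

  ⟦0⟧≡0 : ⟦ K.0# ⟧ ≡ L.0#
  ⟦0⟧≡0 = PL.x+x≈x⇒x≈0 ⟦ K.0# ⟧ (trans (sym (hom-+ K.0# K.0#)) (cong ⟦_⟧ (PK.+-identityʳ K.0#)))

  ⟦⟧-≢0 : ∀ {x} → x ≢ K.0# → ⟦ x ⟧ ≢ L.0#
  ⟦⟧-≢0 {x} x≢0 ⟦x⟧≡0 with K.inverse x x≢0
  ... | y , xy≡1 = L.0≢1 (begin
      L.0#              ≡⟨ PL.zeroˡ ⟦ y ⟧ ⟨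
      L.0# L.* ⟦ y ⟧    ≡⟨ cong (L._* ⟦ y ⟧) ⟦x⟧≡0 ⟨
      ⟦ x ⟧ L.* ⟦ y ⟧   ≡⟨ hom-* x y ⟨
      ⟦ x K.* y ⟧       ≡⟨ cong ⟦_⟧ xy≡1 ⟩
      ⟦ K.1# ⟧          ≡⟨ hom-1 ⟩
      L.1#              ∎)
    where open ≡-Reasoning

  mapₚ : PK.Pol → PL.Pol
  mapₚ = map ⟦_⟧

  mapₚ-+ₚ : ∀ p q → mapₚ (p PK.+ₚ q) ≡ mapₚ p PL.+ₚ mapₚ q
  mapₚ-+ₚ []      q       = refl
  mapₚ-+ₚ (a ∷ p) []      = refl
  mapₚ-+ₚ (a ∷ p) (b ∷ q) = cong₂ _∷_ (hom-+ a b) (mapₚ-+ₚ p q)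

  mapₚ-scale : ∀ a q → mapₚ (PK.scale a q) ≡ PL.scale ⟦ a ⟧ (mapₚ q)
  mapₚ-scale a []      = refl
  mapₚ-scale a (b ∷ q) = cong₂ _∷_ (hom-* a b) (mapₚ-scale a q)

  mapₚ-*ₚ : ∀ p q → mapₚ (p PK.*ₚ q) ≡ mapₚ p PL.*ₚ mapₚ q
  mapₚ-*ₚ []      q = refl
  mapₚ-*ₚ (a ∷ p) q = trans (mapₚ-+ₚ (PK.scale a q) (K.0# ∷ (p PK.*ₚ q)))
    (cong₂ PL._+ₚ_ (mapₚ-scale a q) (cong₂ _∷_ ⟦0⟧≡0 (mapₚ-*ₚ p q)))

  mapₚ-∘ₚ : ∀ g h → mapₚ (g PK.∘ₚ h) ≡ mapₚ g PL.∘ₚ mapₚ h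
  mapₚ-∘ₚ []      h = refl
  mapₚ-∘ₚ (a ∷ g) h = trans (mapₚ-+ₚ (PK.const a) (h PK.*ₚ (g PK.∘ₚ h)))
    (cong (PL.const ⟦ a ⟧ PL.+ₚ_) (trans (mapₚ-*ₚ h (g PK.∘ₚ h)) (cong (mapₚ h PL.*ₚ_) (mapₚ-∘ₚ g h))))

  coeff-mapₚ : ∀ p i → PL.coeff (mapₚ p) i ≡ ⟦ PK.coeff p i ⟧
  coeff-mapₚ []      i       = sym ⟦0⟧≡0
  coeff-mapₚ (a ∷ p) zero    = refl
  coeff-mapₚ (a ∷ p) (suc i) = coeff-mapₚ p i

  mapₚ-≋ : ∀ {p q} → p PK.≋ q → mapₚ p PL.≋ mapₚ q
  mapₚ-≋ {p} {q} p≋q = PL.coeffwise λ i →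
    trans (coeff-mapₚ p i) (trans (cong ⟦_⟧ (PK.coeff-≡ p≋q i)) (sym (coeff-mapₚ q i)))

  mapₚ-decomposition : ∀ {f g h} → f PK.≈ₚ (g PK.∘ₚ h) → mapₚ f PL.≋ (mapₚ g PL.∘ₚ mapₚ h)
  mapₚ-decomposition {f} {g} {h} f≈g∘h = subst (mapₚ f PL.≋_) (mapₚ-∘ₚ g h) (mapₚ-≋ (PK.≈ₚ⇒≋ f≈g∘h))

  deg-mapₚ : ∀ p → PL.deg (mapₚ p) ≡ PK.deg p
  deg-mapₚ p with PK.zero-or-hasDegree p
  ... | inj₁ p≋0 = trans (PL.deg-isZero {mapₚ p} (mapₚ-≋ p≋0)) (sym (PK.deg-isZero {p} p≋0))
  ... | inj₂ p° = PL.hasDegree⇒deg≡ {mapₚ p}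
    ( (λ e → ⟦⟧-≢0 (PK.HasDegree.leading≢0 p°) (trans (sym (coeff-mapₚ p (PK.deg p))) e))
    , λ i deg<i → trans (coeff-mapₚ p i) (trans (cong ⟦_⟧ (PK.HasDegree.bounded p° i deg<i)) ⟦0⟧≡0))

corollary3p5 : (F : FiniteField) (p : ℕ) → HasChar F p →
    (f : Poly.Pol F) → Poly.NotInXp F p f → 8 ≤ Poly.deg F f →
    Universal F f → Poly.Indecomposable F f
corollary3p5 F _ _ f _ 8≤deg (_ , _ , E , universal) g h g<f h<f f≈g∘h =
  let t₀ , P , P-irreducible , degP , P∣f−t₀ =
        universal (Poly.deg F f ∸ 1) (ℕ.≤-trans (s≤s z≤n) (ℕ.∸-monoˡ-≤ 1 8≤deg)) (ℕ.m∸n≤m _ 1)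
  in PL.decomposable⇒no-irreducible-factor-of-degree-pred {mapₚ f} {mapₚ g} {mapₚ h} {P} t₀
       (mapₚ-decomposition {f} {g} {h} f≈g∘h)
       (subst₂ _<_ (sym (deg-mapₚ g)) (sym (deg-mapₚ f)) g<f)
       (subst₂ _<_ (sym (deg-mapₚ h)) (sym (deg-mapₚ f)) h<f)
       P-irreducible (trans degP (cong (_∸ 1) (sym (deg-mapₚ f)))) P∣f−t₀
  where
  open Extension E
  open Transfer ι
  module PL = Polynomials L
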